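{- Let $n>1$, let $k_0,\ldots,k_{n-1}$ be integers and $q,p_0,\ldots,p_{n-1}$ non-zero integers with $\gcd(p_i,q)=1$ for all $i$, and assume $D:=q^n-p_0p_1\cdots p_{n-1}\neq 0$. Extend indices periodically ($p_i=p_j$, $k_i=k_j$ when $i\equiv j \pmod n$), let $B_i(x)=\frac{p_ix+k_i}{q}$, and let $x_i$ be the unique (rational) solution of $B_i\circ B_{i+1}\circ\cdots\circ B_{i+n-1}(x)=x$, namely $$x_i=\frac{p_ip_{i+1}\cdots p_{i+n-2}k_{i-1}+p_ip_{i+1}\cdots p_{i+n-3}k_{i-2}q+\cdots+p_ik_{i+1}q^{n-2}+k_iq^{n-1}}{D},$$ with $x_i=x_j$ when $i\equiv j\pmod n$. Put $U_j=\frac{q^j}{D}$. Let $\alpha,\beta$ be non-zero integers and $b$ an integer with $0<b<n$, and suppose $\alpha U_0+\beta U_b$ is an integer. Then for every $i$ with $0\le i<i+b<n$, the number $\alpha x_i+\beta\, p_ip_{i+1}\cdots p_{i+b-1}\,x_{i+b}$ is an integer.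
   Context: The $x_i$ are the terms of the "rational cycle" of the generalized Collatz-type maps $B_i$; all indices are taken modulo $n$. -}

module Defs where

open import Data.Nat as ℕ using (ℕ; zero; suc; NonZero; _∸_; _%_)
open import Data.Nat.DivMod using (m%n<n)
open import Data.Fin using (Fin; fromℕ<)
open import Data.Integer as ℤ using (ℤ; +_; -[1+_]; +0; +[1+_])
open import Data.Rational as ℚ using (ℚ)
open import Data.Product using (∃)
open import Relation.Binary.PropositionalEquality using (_≡_; _≢_; refl)
open import Data.Empty using (⊥-elim)

per : (n : ℕ) .{{_ : NonZero n}} → (Fin n → ℤ) → ℕ → ℤ
per n a i = a (fromℕ< (m%n<n i n))

prodFrom : (ℕ → ℤ) → ℕ → ℕ → ℤ
prodFrom a i zero      = ℤ.+ 1
prodFrom a i (suc len) = a i ℤ.* prodFrom a (suc i) len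

sumTo : ℕ → (ℕ → ℤ) → ℤ
sumTo zero    f = +0
sumTo (suc m) f = sumTo m f ℤ.+ f m

ι : ℤ → ℚ
ι z = z ℚ./ 1

divℤ : ℤ → (d : ℤ) → d ≢ +0 → ℚ
divℤ a +0          h = ⊥-elim (h refl)
divℤ a +[1+ m ]    h = a ℚ./ suc m
divℤ a -[1+ m ]    h = (ℤ.- a) ℚ./ suc m

IsInt : ℚ → Set
IsInt r = ∃ λ (z : ℤ) → r ≡ ι z

Dval : (n : ℕ) .{{_ : NonZero n}} → (q : ℤ) → (p : Fin n → ℤ) → ℤ
Dval n q p = q ℤ.^ n ℤ.- prodFrom (per n p) 0 n

-- numerator of x_i:
--   Σ_{j=0}^{n-1} p_i p_(i+1) ... p_(i+n-2-j) · k_(i-1-j) · q^j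
-- where k_(i-1-j) = k_(i+(n-1-j)) by periodicity (0 ≤ n-1-j since j < n)
numer : (n : ℕ) .{{_ : NonZero n}} → (q : ℤ) → (p k : Fin n → ℤ) → ℕ → ℤ
numer n q p k i =
  sumTo n (λ j → prodFrom (per n p) i (n ∸ 1 ∸ j) ℤ.* per n k (i ℕ.+ (n ∸ 1 ∸ j)) ℤ.* (q ℤ.^ j))

xval : (n : ℕ) .{{_ : NonZero n}} → (q : ℤ) → (p k : Fin n → ℤ) →
       Dval n q p ≢ +0 → ℕ → ℚ
xval n q p k hD i = divℤ (numer n q p k i) (Dval n q p) hD

Uval : (n : ℕ) .{{_ : NonZero n}} → (q : ℤ) → (p : Fin n → ℤ) →
       Dval n q p ≢ +0 → ℕ → ℚ
Uval n q p hD j = divℤ (q ℤ.^ j) (Dval n q p) hD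

{-# OPTIONS --safe #-}
-- Write Nᵢ for the numerator of xᵢ and D = qⁿ − p₀⋯pₙ₋₁. Evaluating the
-- composite B_i ∘ ⋯ ∘ B_(i+n) in two ways gives q·Nᵢ = pᵢ·Nᵢ₊₁ + kᵢ·D, so
-- q^b·Nᵢ ≡ pᵢ⋯pᵢ₊ᵦ₋₁·Nᵢ₊ᵦ modulo D. The hypothesis says that D divides
-- α + β·q^b, hence D also divides α·Nᵢ + β·pᵢ⋯pᵢ₊ᵦ₋₁·Nᵢ₊ᵦ, which is D times
-- the rational number in question.
module Submission where

open import Defs
open import Data.Nat as ℕ using (ℕ; NonZero; zero; suc; _∸_)
open import Data.Nat.DivMod using (m%n<n; [m+n]%n≡m%n)
import Data.Nat.Properties as ℕP
open import Data.Fin using (Fin)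
open import Data.Fin.Properties using (fromℕ<-cong)
open import Data.Integer as ℤ using (ℤ; +0; +[1+_]; -[1+_]; _+_; _*_; _-_; _^_)
import Data.Integer.Properties as ℤP
open import Data.Integer.GCD using (gcd)
open import Data.Integer.Tactic.RingSolver using (solve-∀)
open import Data.Rational as ℚ using (ℚ; 0ℚ; 1ℚ)
import Data.Rational.Properties as ℚP
open import Data.Rational.Unnormalised as ℚᵘ using (mkℚᵘ; *≡*)
import Data.Rational.Unnormalised.Properties as ℚᵘP
open import Data.Product using (∃; _,_)
open import Data.Empty using (⊥-elim)
open import Function.Bundles using (_⇔_; mk⇔; Equivalence)
open import Relation.Binary.PropositionalEquality

ι-toℚᵘ : ∀ a → ℚ.toℚᵘ (ι a) ℚᵘ.≃ mkℚᵘ a 0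
ι-toℚᵘ a = ℚP.toℚᵘ-fromℚᵘ (mkℚᵘ a 0)

ι-injective : ∀ {a b} → ι a ≡ ι b → a ≡ b
ι-injective {a} {b} eq with ℚP.fromℚᵘ-injective {mkℚᵘ a 0} {mkℚᵘ b 0} eq
... | *≡* a*1≡b*1 = trans (sym (ℤP.*-identityʳ a)) (trans a*1≡b*1 (ℤP.*-identityʳ b))

ι-homo-+ : ∀ a b → ι (a + b) ≡ ι a ℚ.+ ι b
ι-homo-+ a b = ℚP.toℚᵘ-injective (ℚᵘP.≃-trans (ι-toℚᵘ (a + b)) (ℚᵘP.≃-trans (*≡* (denominators-one a b))
  (ℚᵘP.≃-trans (ℚᵘP.+-cong (ℚᵘP.≃-sym (ι-toℚᵘ a)) (ℚᵘP.≃-sym (ι-toℚᵘ b)))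
    (ℚᵘP.≃-sym (ℚP.toℚᵘ-homo-+ (ι a) (ι b))))))
  where
  denominators-one : ∀ a b → (a + b) * ℤ.+ 1 ≡ (a * ℤ.+ 1 + b * ℤ.+ 1) * ℤ.+ 1
  denominators-one = solve-∀

ι-homo-* : ∀ a b → ι (a * b) ≡ ι a ℚ.* ι b
ι-homo-* a b = ℚP.toℚᵘ-injective (ℚᵘP.≃-trans (ι-toℚᵘ (a * b)) (ℚᵘP.≃-trans (*≡* refl)
  (ℚᵘP.≃-trans (ℚᵘP.*-cong (ℚᵘP.≃-sym (ι-toℚᵘ a)) (ℚᵘP.≃-sym (ι-toℚᵘ b)))
    (ℚᵘP.≃-sym (ℚP.toℚᵘ-homo-* (ι a) (ι b))))))

divℤ-*-ι : ∀ a d (d≢0 : d ≢ +0) → divℤ a d d≢0 ℚ.* ι d ≡ ι a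
divℤ-*-ι a +0 d≢0 = ⊥-elim (d≢0 refl)
divℤ-*-ι a +[1+ m ] d≢0 = ℚP.toℚᵘ-injective
  (ℚᵘP.≃-trans (ℚP.toℚᵘ-homo-* (divℤ a +[1+ m ] d≢0) (ι +[1+ m ]))
  (ℚᵘP.≃-trans (ℚᵘP.*-cong (ℚP.toℚᵘ-fromℚᵘ (mkℚᵘ a m)) (ι-toℚᵘ +[1+ m ]))
  (ℚᵘP.≃-trans (*≡* (trans (lemma a +[1+ m ]) (cong (λ z → a * ℤ.+ z) (sym (ℕP.*-identityʳ (suc m))))))
    (ℚᵘP.≃-sym (ι-toℚᵘ a)))))
  where
  lemma : ∀ a x → a * x * ℤ.+ 1 ≡ a * x
  lemma = solve-∀
divℤ-*-ι a -[1+ m ] d≢0 = ℚP.toℚᵘ-injective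
  (ℚᵘP.≃-trans (ℚP.toℚᵘ-homo-* (divℤ a -[1+ m ] d≢0) (ι -[1+ m ]))
  (ℚᵘP.≃-trans (ℚᵘP.*-cong (ℚP.toℚᵘ-fromℚᵘ (mkℚᵘ (ℤ.- a) m)) (ι-toℚᵘ -[1+ m ]))
  (ℚᵘP.≃-trans (*≡* (trans (lemma a +[1+ m ]) (cong (λ z → a * ℤ.+ z) (sym (ℕP.*-identityʳ (suc m))))))
    (ℚᵘP.≃-sym (ι-toℚᵘ a)))))
  where
  lemma : ∀ a x → (ℤ.- a) * (ℤ.- x) * ℤ.+ 1 ≡ a * x
  lemma = solve-∀

*-cancelʳ-≡ : ∀ r s x → x ≢ 0ℚ → r ℚ.* x ≡ s ℚ.* x → r ≡ s
*-cancelʳ-≡ r s x x≢0 eq = begin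
  r                        ≡⟨ sym (ℚP.*-identityʳ r) ⟩
  r ℚ.* 1ℚ                 ≡⟨ cong (r ℚ.*_) (sym (ℚP.*-inverseʳ x)) ⟩
  r ℚ.* (x ℚ.* ℚ.1/ x)     ≡⟨ sym (ℚP.*-assoc r x _) ⟩
  (r ℚ.* x) ℚ.* ℚ.1/ x     ≡⟨ cong (ℚ._* ℚ.1/ x) eq ⟩
  (s ℚ.* x) ℚ.* ℚ.1/ x     ≡⟨ ℚP.*-assoc s x _ ⟩
  s ℚ.* (x ℚ.* ℚ.1/ x)     ≡⟨ cong (s ℚ.*_) (ℚP.*-inverseʳ x) ⟩
  s ℚ.* 1ℚ                 ≡⟨ ℚP.*-identityʳ s ⟩
  s                        ∎
  where
  open ≡-Reasoning
  instance
    x-nonZero : ℚ.NonZero x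
    x-nonZero = ℚ.≢-nonZero x≢0

combination-divℤ≡ι⇔ : ∀ u v a b z d (d≢0 : d ≢ +0) →
  (ι u ℚ.* divℤ a d d≢0 ℚ.+ ι v ℚ.* divℤ b d d≢0 ≡ ι z) ⇔ (u * a + v * b ≡ z * d)
combination-divℤ≡ι⇔ u v a b z d d≢0 = mk⇔
  (λ eq → ι-injective (begin
    ι (u * a + v * b)  ≡⟨ sym scaled ⟩
    r ℚ.* ι d          ≡⟨ cong (ℚ._* ι d) eq ⟩
    ι z ℚ.* ι d        ≡⟨ sym (ι-homo-* z d) ⟩
    ι (z * d)          ∎))
  (λ eq → *-cancelʳ-≡ r (ι z) (ι d) (λ ιd≡0 → d≢0 (ι-injective ιd≡0)) (begin
    r ℚ.* ι d          ≡⟨ scaled ⟩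
    ι (u * a + v * b)  ≡⟨ cong ι eq ⟩
    ι (z * d)          ≡⟨ ι-homo-* z d ⟩
    ι z ℚ.* ι d        ∎))
  where
  open ≡-Reasoning
  x = divℤ a d d≢0
  y = divℤ b d d≢0
  r = ι u ℚ.* x ℚ.+ ι v ℚ.* y
  scaled : r ℚ.* ι d ≡ ι (u * a + v * b)
  scaled = begin
    (ι u ℚ.* x ℚ.+ ι v ℚ.* y) ℚ.* ι d                ≡⟨ ℚP.*-distribʳ-+ (ι d) (ι u ℚ.* x) (ι v ℚ.* y) ⟩
    ι u ℚ.* x ℚ.* ι d ℚ.+ ι v ℚ.* y ℚ.* ι d          ≡⟨ cong₂ ℚ._+_ (ℚP.*-assoc (ι u) x (ι d)) (ℚP.*-assoc (ι v) y (ι d)) ⟩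
    ι u ℚ.* (x ℚ.* ι d) ℚ.+ ι v ℚ.* (y ℚ.* ι d)      ≡⟨ cong₂ (λ s t → ι u ℚ.* s ℚ.+ ι v ℚ.* t) (divℤ-*-ι a d d≢0) (divℤ-*-ι b d d≢0) ⟩
    ι u ℚ.* ι a ℚ.+ ι v ℚ.* ι b                      ≡⟨ sym (cong₂ ℚ._+_ (ι-homo-* u a) (ι-homo-* v b)) ⟩
    ι (u * a) ℚ.+ ι (v * b)                          ≡⟨ sym (ι-homo-+ (u * a) (v * b)) ⟩
    ι (u * a + v * b)                                ∎

sumTo-cong : ∀ m (f g : ℕ → ℤ) → (∀ j → j ℕ.< m → f j ≡ g j) → sumTo m f ≡ sumTo m g
sumTo-cong zero    f g f≗g = refl
sumTo-cong (suc m) f g f≗g =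
  cong₂ _+_ (sumTo-cong m f g (λ j j<m → f≗g j (ℕP.m<n⇒m<1+n j<m))) (f≗g m ℕP.≤-refl)

*-distribˡ-sumTo : ∀ m s (f : ℕ → ℤ) → sumTo m (λ j → s * f j) ≡ s * sumTo m f
*-distribˡ-sumTo zero    s f = sym (ℤP.*-zeroʳ s)
*-distribˡ-sumTo (suc m) s f =
  trans (cong (_+ s * f m) (*-distribˡ-sumTo m s f)) (sym (ℤP.*-distribˡ-+ s (sumTo m f) (f m)))

prodFrom-suc : ∀ a i m → prodFrom a i (suc m) ≡ prodFrom a i m * a (i ℕ.+ m)
prodFrom-suc a i zero    rewrite ℕP.+-identityʳ i = trans (ℤP.*-identityʳ (a i)) (sym (ℤP.*-identityˡ (a i)))
prodFrom-suc a i (suc m) rewrite prodFrom-suc a (suc i) m | ℕP.+-suc i m =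
  sym (ℤP.*-assoc (a i) (prodFrom a (suc i) m) (a (suc i ℕ.+ m)))

-- With Bᵢ(x) = (aᵢx + cᵢ)/q, one has
-- q^m · (Bᵢ ∘ Bᵢ₊₁ ∘ ⋯ ∘ Bᵢ₊ₘ₋₁)(x) = prodFrom a i m · x + offset a c q i m.
offset : (ℕ → ℤ) → (ℕ → ℤ) → ℤ → ℕ → ℕ → ℤ
offset a c q i zero    = +0
offset a c q i (suc m) = c i * q ^ m + a i * offset a c q (suc i) m

offset-suc : ∀ a c q i m → offset a c q i (suc m) ≡ q * offset a c q i m + prodFrom a i m * c (i ℕ.+ m)
offset-suc a c q i zero    rewrite ℕP.+-identityʳ i = lemma q (c i) (a i)
  where
  lemma : ∀ q cᵢ aᵢ → cᵢ * ℤ.+ 1 + aᵢ * +0 ≡ q * +0 + ℤ.+ 1 * cᵢ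
  lemma = solve-∀
offset-suc a c q i (suc m) rewrite offset-suc a c q (suc i) m | ℕP.+-suc i m =
  lemma (c i) q (q ^ m) (a i) (offset a c q (suc i) m) (prodFrom a (suc i) m) (c (suc i ℕ.+ m))
  where
  lemma : ∀ cᵢ q qᵐ aᵢ h p c → cᵢ * (q * qᵐ) + aᵢ * (q * h + p * c) ≡ q * (cᵢ * qᵐ + aᵢ * h) + aᵢ * p * c
  lemma = solve-∀

offset≡sumTo : ∀ a c q i m →
  offset a c q i m ≡ sumTo m (λ j → prodFrom a i (m ∸ 1 ∸ j) * c (i ℕ.+ (m ∸ 1 ∸ j)) * q ^ j)
offset≡sumTo a c q i zero    = refl
offset≡sumTo a c q i (suc m) = sym (begin
  sumTo m (λ j → prodFrom a i (m ∸ j) * c (i ℕ.+ (m ∸ j)) * q ^ j)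
    + prodFrom a i (m ∸ m) * c (i ℕ.+ (m ∸ m)) * q ^ m
    ≡⟨ cong₂ _+_ (sumTo-cong m _ _ shift) last ⟩
  sumTo m (λ j → a i * (prodFrom a (suc i) (m ∸ 1 ∸ j) * c (suc i ℕ.+ (m ∸ 1 ∸ j)) * q ^ j))
    + c i * q ^ m
    ≡⟨ cong (_+ c i * q ^ m) (*-distribˡ-sumTo m (a i) _) ⟩
  a i * sumTo m (λ j → prodFrom a (suc i) (m ∸ 1 ∸ j) * c (suc i ℕ.+ (m ∸ 1 ∸ j)) * q ^ j)
    + c i * q ^ m
    ≡⟨ cong (λ s → a i * s + c i * q ^ m) (sym (offset≡sumTo a c q (suc i) m)) ⟩
  a i * offset a c q (suc i) m + c i * q ^ m
    ≡⟨ ℤP.+-comm (a i * offset a c q (suc i) m) (c i * q ^ m) ⟩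
  offset a c q i (suc m) ∎)
  where
  open ≡-Reasoning
  last : prodFrom a i (m ∸ m) * c (i ℕ.+ (m ∸ m)) * q ^ m ≡ c i * q ^ m
  last rewrite ℕP.n∸n≡0 m | ℕP.+-identityʳ i = cong (_* q ^ m) (ℤP.*-identityˡ (c i))
  shift : ∀ j → j ℕ.< m → prodFrom a i (m ∸ j) * c (i ℕ.+ (m ∸ j)) * q ^ j
        ≡ a i * (prodFrom a (suc i) (m ∸ 1 ∸ j) * c (suc i ℕ.+ (m ∸ 1 ∸ j)) * q ^ j)
  shift j (ℕ.s≤s {n = m′} j≤m′) rewrite ℕP.+-∸-assoc 1 j≤m′ | ℕP.+-suc i (m′ ∸ j) =
    assoc (a i) (prodFrom a (suc i) (m′ ∸ j)) (c (suc i ℕ.+ (m′ ∸ j))) (q ^ j)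
    where
    assoc : ∀ x y z w → x * y * z * w ≡ x * (y * z * w)
    assoc = solve-∀

per-periodic : ∀ n .{{_ : NonZero n}} (a : Fin n → ℤ) j → per n a (j ℕ.+ n) ≡ per n a j
per-periodic n a j = cong a (fromℕ<-cong _ _ ([m+n]%n≡m%n j n) (m%n<n (j ℕ.+ n) n) (m%n<n j n))

prodFrom-shift : ∀ a n → (∀ j → a (j ℕ.+ n) ≡ a j) → ∀ i → prodFrom a (suc i) n ≡ prodFrom a i n
prodFrom-shift a zero    a-periodic i = refl
prodFrom-shift a (suc m) a-periodic i = begin
  prodFrom a (suc i) (suc m)             ≡⟨ prodFrom-suc a (suc i) m ⟩
  prodFrom a (suc i) m * a (suc i ℕ.+ m) ≡⟨ cong (λ j → prodFrom a (suc i) m * a j) (sym (ℕP.+-suc i m)) ⟩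
  prodFrom a (suc i) m * a (i ℕ.+ suc m) ≡⟨ cong (prodFrom a (suc i) m *_) (a-periodic i) ⟩
  prodFrom a (suc i) m * a i             ≡⟨ ℤP.*-comm (prodFrom a (suc i) m) (a i) ⟩
  prodFrom a i (suc m)                   ∎
  where open ≡-Reasoning

prodFrom-periodic : ∀ a n → (∀ j → a (j ℕ.+ n) ≡ a j) → ∀ i → prodFrom a i n ≡ prodFrom a 0 n
prodFrom-periodic a n a-periodic zero    = refl
prodFrom-periodic a n a-periodic (suc i) =
  trans (prodFrom-shift a n a-periodic i) (prodFrom-periodic a n a-periodic i)

module Cycle (n : ℕ) (a c : ℕ → ℤ) (a-periodic : ∀ j → a (j ℕ.+ n) ≡ a j)
             (c-periodic : ∀ j → c (j ℕ.+ n) ≡ c j) (q : ℤ) where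

  N : ℕ → ℤ
  N i = offset a c q i n

  D : ℤ
  D = q ^ n - prodFrom a 0 n

  -- Compare the two recursive expansions of offset a c q i (n + 1), using periodicity.
  q*N≡a*N[suc]+c*D : ∀ i → q * N i ≡ a i * N (suc i) + c i * D
  q*N≡a*N[suc]+c*D i = begin
    q * N i                                        ≡⟨ lemma (q * N i) (prodFrom a 0 n) (c i) ⟩
    q * N i + prodFrom a 0 n * c i - prodFrom a 0 n * c i
      ≡⟨ cong (λ s → s - prodFrom a 0 n * c i) (sym two-expansions) ⟩
    c i * q ^ n + a i * N (suc i) - prodFrom a 0 n * c i
      ≡⟨ rearrange (c i) (q ^ n) (a i) (N (suc i)) (prodFrom a 0 n) ⟩
    a i * N (suc i) + c i * D                      ∎
    where
    open ≡-Reasoning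
    two-expansions : c i * q ^ n + a i * N (suc i) ≡ q * N i + prodFrom a 0 n * c i
    two-expansions = trans (offset-suc a c q i n)
      (cong₂ (λ s t → q * N i + s * t) (prodFrom-periodic a n a-periodic i) (c-periodic i))
    lemma : ∀ x y z → x ≡ x + y * z - y * z
    lemma = solve-∀
    rearrange : ∀ cᵢ qⁿ aᵢ N′ P → cᵢ * qⁿ + aᵢ * N′ - P * cᵢ ≡ aᵢ * N′ + cᵢ * (qⁿ - P)
    rearrange = solve-∀

  q^b*N≡prodFrom*N[+b]+D*C : ∀ b i → ∃ λ C → q ^ b * N i ≡ prodFrom a i b * N (i ℕ.+ b) + D * C
  q^b*N≡prodFrom*N[+b]+D*C zero i rewrite ℕP.+-identityʳ i = +0 , lemma (N i) D
    where
    lemma : ∀ x d → ℤ.+ 1 * x ≡ ℤ.+ 1 * x + d * +0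
    lemma = solve-∀
  q^b*N≡prodFrom*N[+b]+D*C (suc b) i with q^b*N≡prodFrom*N[+b]+D*C b (suc i)
  ... | C , eq = a i * C + q ^ b * c i , (begin
    q * q ^ b * N i                                         ≡⟨ l₁ q (q ^ b) (N i) ⟩
    q ^ b * (q * N i)                                       ≡⟨ cong (q ^ b *_) (q*N≡a*N[suc]+c*D i) ⟩
    q ^ b * (a i * N (suc i) + c i * D)                     ≡⟨ l₂ (q ^ b) (a i) (N (suc i)) (c i) D ⟩
    a i * (q ^ b * N (suc i)) + q ^ b * c i * D             ≡⟨ cong (λ s → a i * s + q ^ b * c i * D) eq ⟩
    a i * (P * N (suc i ℕ.+ b) + D * C) + q ^ b * c i * D
      ≡⟨ cong (λ j → a i * (P * N j + D * C) + q ^ b * c i * D) (sym (ℕP.+-suc i b)) ⟩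
    a i * (P * N (i ℕ.+ suc b) + D * C) + q ^ b * c i * D   ≡⟨ l₃ (a i) P (N (i ℕ.+ suc b)) D C (q ^ b * c i) ⟩
    a i * P * N (i ℕ.+ suc b) + D * (a i * C + q ^ b * c i) ∎)
    where
    open ≡-Reasoning
    P = prodFrom a (suc i) b
    l₁ : ∀ x y z → x * y * z ≡ y * (x * z)
    l₁ = solve-∀
    l₂ : ∀ y a n c d → y * (a * n + c * d) ≡ a * (y * n) + y * c * d
    l₂ = solve-∀
    l₃ : ∀ a p n d C e → a * (p * n + d * C) + e * d ≡ a * p * n + d * (a * C + e)
    l₃ = solve-∀

  D∣combination : ∀ α β w b i → α * q ^ 0 + β * q ^ b ≡ w * D →
    ∃ λ z → α * N i + β * prodFrom a i b * N (i ℕ.+ b) ≡ z * D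
  D∣combination α β w b i α+βq^b≡wD with q^b*N≡prodFrom*N[+b]+D*C b i
  ... | C , eq = w * N i - β * C , (begin
    α * N i + β * P * M                                  ≡⟨ l₁ α β (q ^ b) (N i) P M ⟩
    (α * q ^ 0 + β * q ^ b) * N i - β * (q ^ b * N i) + β * (P * M)
      ≡⟨ cong₂ (λ s t → s * N i - β * t + β * (P * M)) α+βq^b≡wD eq ⟩
    w * D * N i - β * (P * M + D * C) + β * (P * M)      ≡⟨ l₂ w D (N i) β P M C ⟩
    (w * N i - β * C) * D                                ∎)
    where
    open ≡-Reasoning
    P = prodFrom a i b
    M = N (i ℕ.+ b)
    l₁ : ∀ α β qᵇ N P M → α * N + β * P * M ≡ (α * ℤ.+ 1 + β * qᵇ) * N - β * (qᵇ * N) + β * (P * M)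
    l₁ = solve-∀
    l₂ : ∀ w D N β P M C → w * D * N - β * (P * M + D * C) + β * (P * M) ≡ (w * N - β * C) * D
    l₂ = solve-∀

theorem3p1 : (n : ℕ) .{{_ : NonZero n}} → 1 ℕ.< n →
    (k p : Fin n → ℤ) → (q : ℤ) →
    q ≢ +0 → (∀ i → p i ≢ +0) → (∀ i → gcd (p i) q ≡ ℤ.+ 1) →
    (hD : Dval n q p ≢ +0) →
    (α β : ℤ) → α ≢ +0 → β ≢ +0 →
    (b : ℕ) → 0 ℕ.< b → b ℕ.< n →
    IsInt (ι α ℚ.* Uval n q p hD 0 ℚ.+ ι β ℚ.* Uval n q p hD b) →
    (i : ℕ) → i ℕ.+ b ℕ.< n →
    IsInt (ι α ℚ.* xval n q p k hD i
           ℚ.+ ι β ℚ.* ι (prodFrom (per n p) i b) ℚ.* xval n q p k hD (i ℕ.+ b))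
theorem3p1 n _ k p q _ _ _ hD α β _ _ b _ _ (w , αU₀+βUᵦ≡w) i _ =
  let z , αN+βPM≡zD = D∣combination α β w b i α+βq^b≡wD in
  z , trans (cong (λ s → ι α ℚ.* X ℚ.+ s ℚ.* Y) (sym (ι-homo-* β P)))
            (Equivalence.from (combination-divℤ≡ι⇔ α (β * P) _ _ z D hD)
              (trans (cong₂ (λ s t → α * s + β * P * t) (numer≡N i) (numer≡N (i ℕ.+ b))) αN+βPM≡zD))
  where
  open Cycle n (per n p) (per n k) (per-periodic n p) (per-periodic n k) q
  P = prodFrom (per n p) i b
  X = xval n q p k hD i
  Y = xval n q p k hD (i ℕ.+ b)
  numer≡N : ∀ j → numer n q p k j ≡ N j
  numer≡N j = sym (offset≡sumTo (per n p) (per n k) q j n)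
  α+βq^b≡wD : α * q ^ 0 + β * q ^ b ≡ w * D
  α+βq^b≡wD = Equivalence.to (combination-divℤ≡ι⇔ α β (q ^ 0) (q ^ b) w D hD) αU₀+βUᵦ≡w
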